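{- Let $\alpha_1,\dots,\alpha_u$ and $\beta_1,\dots,\beta_v$ be positive integers, let $B=\beta_1+\cdots+\beta_v$, and let $\Phi=\sum_{i=1}^u\alpha_iP_4(x_i)+\sum_{j=1}^v\beta_jP_8(y_j)$, where $P_4(x)=x^2$ and $P_8(y)=3y^2-2y$. Let $E=\{n\in\mathbb{Z}: 1\le n<B,\ n\equiv B \pmod 3\}$ and for each $n\in E$ let $\nu(n)$ be the positive integer with $4^{\nu(n)-1}n<B\le 4^{\nu(n)}n$. Assume that for every $n\in E$ the equation $$3\alpha_1x_1^2+\cdots+3\alpha_ux_u^2+\beta_1y_1^2+\cdots+\beta_vy_v^2=4^{\nu(n)}\cdot n$$ has an integer solution with $y_1\cdots y_v\not\equiv 0\pmod 3$. Then $\Phi$ is universal (i.e. $\Phi=N$ is solvable in integers for every nonnegative integer $N$) if and only if the equation $$3\alpha_1x_1^2+\cdots+3\alpha_ux_u^2+\beta_1y_1^2+\cdots+\beta_vy_v^2=3N+B$$ has an integer solution with $y_1\cdots y_v\not\equiv0\pmod 3$ for every nonnegative integer $N$ with $3N+B\not\equiv 0\pmod 4$.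
   Context: Generalized $m$-gonal numbers are $P_m(x)=\frac{(m-2)x^2-(m-4)x}{2}$, $x\in\mathbb{Z}$. An empty product $y_1\cdots y_v$ (when $v=0$) is $1$. -}

module Defs where

open import Data.Nat as ℕ using (ℕ; _^_; _%_)
open import Data.Integer as ℤ using (ℤ; +_; _+_; _*_; _-_)
open import Data.Integer.Divisibility as ℤD using ()
open import Data.Vec using (Vec; []; _∷_)
open import Data.Product using (Σ; ∃; _×_; _,_)
open import Relation.Nullary using (¬_)
open import Relation.Binary.PropositionalEquality using (_≡_)

P4 : ℤ → ℤ
P4 x = x * x

P8 : ℤ → ℤ
P8 y = + 3 * (y * y) - + 2 * y

wsum : ∀ {n} → (ℤ → ℤ) → Vec ℕ n → Vec ℤ n → ℤ
wsum f []       []       = + 0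
wsum f (c ∷ cs) (x ∷ xs) = + c * f x + wsum f cs xs

Φ : ∀ {u v} → Vec ℕ u → Vec ℕ v → Vec ℤ u → Vec ℤ v → ℤ
Φ α β x y = wsum P4 α x + wsum P8 β y

Q : ∀ {u v} → Vec ℕ u → Vec ℕ v → Vec ℤ u → Vec ℤ v → ℤ
Q α β x y = + 3 * wsum P4 α x + wsum P4 β y

prodℤ : ∀ {n} → Vec ℤ n → ℤ
prodℤ []       = + 1
prodℤ (y ∷ ys) = y * prodℤ ys

sumℕ : ∀ {n} → Vec ℕ n → ℕ
sumℕ []       = 0
sumℕ (b ∷ bs) = b ℕ.+ sumℕ bs

AllPos : ∀ {n} → Vec ℕ n → Set
AllPos []       = Data.Unit.⊤ where import Data.Unit
AllPos (c ∷ cs) = (1 ℕ.≤ c) × AllPos cs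

QSolvable : ∀ {u v} → Vec ℕ u → Vec ℕ v → ℤ → Set
QSolvable {u} {v} α β m =
  Σ (Vec ℤ u) λ x → Σ (Vec ℤ v) λ y →
    (Q α β x y ≡ m) × ¬ (+ 3 ℤD.∣ prodℤ y)

Universal : ∀ {u v} → Vec ℕ u → Vec ℕ v → Set
Universal {u} {v} α β =
  (N : ℕ) → Σ (Vec ℤ u) λ x → Σ (Vec ℤ v) λ y → Φ α β x y ≡ + N

InE : ℕ → ℕ → Set
InE B n = (1 ℕ.≤ n) × (n ℕ.< B) × (n % 3 ≡ B % 3)

IsNu : ℕ → ℕ → ℕ → Set
IsNu B n k = (1 ℕ.≤ k) × (4 ^ (k ℕ.∸ 1) ℕ.* n ℕ.< B) × (B ℕ.≤ 4 ^ k ℕ.* n)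

-- The substitution z = 3y − 1 turns P₈ into squares: (3y − 1)² = 3 P₈(y) + 1, and
-- every integer prime to 3 is ±(3y − 1) for some y. Hence Φ(x, y) = N exactly when
-- Q(x, 3y − 1) = 3N + B, and universality of Φ is the solvability of Q = 3N + B with
-- y₁⋯y_v prime to 3. When 4 ∣ 3N + B = 4q, the solution for 4q is twice one for q;
-- if q ≥ B then q is again of the form 3N' + B with N' < N, and if q < B then q ∈ E
-- with ν(q) = 1, so the hypothesis applies.
module Submission where

open import Defs
open import Data.Nat using (ℕ; _^_; _*_; _+_)
open import Data.Nat.Divisibility using (_∣_)
open import Data.Integer using (+_)
open import Data.Vec using (Vec)
open import Function.Bundles using (_⇔_)
open import Relation.Nullary using (¬_)

open import Data.Nat as ℕ using (zero; suc; _∸_; _%_; _<_; _≤_; _<?_; z≤n; s≤s; NonZero)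
import Data.Nat.Properties as ℕ
import Data.Nat.Divisibility as ℕ
open import Data.Nat.DivMod using (m≡m%n+[m/n]*n; %-remove-+ˡ; %-remove-+ʳ; _/_)
open import Data.Nat.Primality using (Prime; prime?; euclidsLemma; prime⇒nonTrivial)
open import Data.Nat.Induction using (<-rec)
open import Data.Integer as ℤ using (ℤ; ∣_∣) renaming (_*_ to _*ℤ_; _+_ to _+ℤ_; _-_ to _-ℤ_)
import Data.Integer.Properties as ℤ
import Data.Integer.Divisibility as ℤ
import Data.Integer.Divisibility.Signed as ℤˢ
open import Data.Integer.DivMod using (_/ℕ_; _%ℕ_; a≡a%ℕn+[a/ℕn]*n; n%ℕd<d)
open import Data.Integer.Tactic.RingSolver using (solve-∀)
open import Algebra.Properties.AbelianGroup ℤ.+-0-abelianGroup using (∙-cancelʳ)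
open import Data.Vec using ([]; _∷_; map; replicate)
open import Data.Vec.Relation.Unary.All as All using (All; []; _∷_)
open import Data.Vec.Relation.Unary.All.Properties using (map⁺)
open import Data.Product using (Σ; _,_)
open import Data.Sum using ([_,_]′)
open import Function.Base using (_∘_)
open import Function.Bundles using (mk⇔; Equivalence)
open import Relation.Nullary using (yes; no; contradiction)
open import Relation.Nullary.Decidable using (from-yes; from-no)
open import Relation.Binary.PropositionalEquality

private
  variable
    u v n : ℕ

prime-3 : Prime 3
prime-3 = from-yes (prime? 3)

∤*ˡ : ∀ {k} i j → ¬ k ℤ.∣ i *ℤ j → ¬ k ℤ.∣ i
∤*ˡ i j k∤ij k∣i = k∤ij (subst (_ ℕ.∣_) (sym (ℤ.abs-* i j)) (ℕ.∣m⇒∣m*n ∣ j ∣ k∣i))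

∤*ʳ : ∀ {k} i j → ¬ k ℤ.∣ i *ℤ j → ¬ k ℤ.∣ j
∤*ʳ i j k∤ij k∣j = k∤ij (subst (_ ℕ.∣_) (sym (ℤ.abs-* i j)) (ℕ.∣n⇒∣m*n ∣ i ∣ k∣j))

prime∤* : ∀ {p} → Prime p → ∀ i j → ¬ + p ℤ.∣ i → ¬ + p ℤ.∣ j → ¬ + p ℤ.∣ i *ℤ j
prime∤* pr i j p∤i p∤j p∣ij =
  [ p∤i , p∤j ]′ (euclidsLemma ∣ i ∣ ∣ j ∣ pr (subst (_ ℕ.∣_) (ℤ.abs-* i j) p∣ij))

prime∤prodℤ⇔All∤ : ∀ {p} → Prime p → (ys : Vec ℤ n) →
  (¬ + p ℤ.∣ prodℤ ys) ⇔ All (λ y → ¬ + p ℤ.∣ y) ys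
prime∤prodℤ⇔All∤ {p = p} pr ys = mk⇔ (∤prod⇒All∤ ys) All∤⇒∤prod
  where
  ∤prod⇒All∤ : ∀ {n} (ys : Vec ℤ n) → ¬ + p ℤ.∣ prodℤ ys → All (λ y → ¬ + p ℤ.∣ y) ys
  ∤prod⇒All∤ []       _ = []
  ∤prod⇒All∤ (y ∷ ys) p∤ = ∤*ˡ {+ p} y (prodℤ ys) p∤ ∷ ∤prod⇒All∤ ys (∤*ʳ {+ p} y (prodℤ ys) p∤)
  All∤⇒∤prod : ∀ {n} {ys : Vec ℤ n} → All (λ y → ¬ + p ℤ.∣ y) ys → ¬ + p ℤ.∣ prodℤ ys
  All∤⇒∤prod []                       p∣1 = ℕ.nonTrivial⇒≢1 {{prime⇒nonTrivial pr}} (ℕ.∣1⇒≡1 p∣1)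
  All∤⇒∤prod {ys = y ∷ ys} (p∤y ∷ p∤ys) = prime∤* pr y (prodℤ ys) p∤y (All∤⇒∤prod p∤ys)

3y-1 : ℤ → ℤ
3y-1 y = + 3 *ℤ y -ℤ + 1

P4[3y-1]≡3P8+1 : ∀ y → P4 (3y-1 y) ≡ + 3 *ℤ P8 y +ℤ + 1
P4[3y-1]≡3P8+1 = ring
  where
  ring : ∀ y → (+ 3 *ℤ y -ℤ + 1) *ℤ (+ 3 *ℤ y -ℤ + 1) ≡ + 3 *ℤ (+ 3 *ℤ (y *ℤ y) -ℤ + 2 *ℤ y) +ℤ + 1
  ring = solve-∀

3∤3y-1 : ∀ y → ¬ + 3 ℤ.∣ 3y-1 y
3∤3y-1 y 3∣ = contradiction (ℕ.∣1⇒≡1 (ℤˢ.∣⇒∣ᵤ 3∣-1)) λ ()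
  where
  3∣-1 : + 3 ℤˢ.∣ ℤ.- + 1
  3∣-1 = ℤˢ.∣m+n∣m⇒∣n (ℤˢ.∣ᵤ⇒∣ 3∣) (ℤˢ.∣m⇒∣m*n y ℤˢ.∣-refl)

-- z = ±(3y − 1), according as z ≡ 2 or z ≡ 1 (mod 3).
3∤⇒P4≡P4[3y-1] : ∀ z → ¬ + 3 ℤ.∣ z → Σ ℤ λ y → P4 z ≡ P4 (3y-1 y)
3∤⇒P4≡P4[3y-1] z 3∤z with z %ℕ 3 | n%ℕd<d z 3 | a≡a%ℕn+[a/ℕn]*n z 3
... | 0 | _ | z≡ = contradiction (ℤˢ.∣⇒∣ᵤ (ℤˢ.divides (z /ℕ 3) (trans z≡ (ℤ.+-identityˡ _)))) 3∤z
... | 1 | _ | z≡ = ℤ.- (z /ℕ 3) , trans (cong P4 z≡) (ring (z /ℕ 3))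
  where
  ring : ∀ q → (+ 1 +ℤ q *ℤ + 3) *ℤ (+ 1 +ℤ q *ℤ + 3) ≡ (+ 3 *ℤ ℤ.- q -ℤ + 1) *ℤ (+ 3 *ℤ ℤ.- q -ℤ + 1)
  ring = solve-∀
... | 2 | _ | z≡ = z /ℕ 3 +ℤ + 1 , trans (cong P4 z≡) (ring (z /ℕ 3))
  where
  ring : ∀ q → (+ 2 +ℤ q *ℤ + 3) *ℤ (+ 2 +ℤ q *ℤ + 3) ≡ (+ 3 *ℤ (q +ℤ + 1) -ℤ + 1) *ℤ (+ 3 *ℤ (q +ℤ + 1) -ℤ + 1)
  ring = solve-∀
... | suc (suc (suc _)) | s≤s (s≤s (s≤s ())) | _

wsum-map : ∀ {f g h : ℤ → ℤ} a b → (∀ x → f (g x) ≡ a *ℤ h x +ℤ b) →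
  (cs : Vec ℕ n) (xs : Vec ℤ n) → wsum f cs (map g xs) ≡ a *ℤ wsum h cs xs +ℤ b *ℤ + sumℕ cs
wsum-map a b fg≡ []       []       = ring a b
  where
  ring : ∀ a b → + 0 ≡ a *ℤ + 0 +ℤ b *ℤ + 0
  ring = solve-∀
wsum-map {f = f} {g} {h} a b fg≡ (c ∷ cs) (x ∷ xs) = begin
  + c *ℤ f (g x) +ℤ wsum f cs (map g xs)
    ≡⟨ cong₂ (λ s t → + c *ℤ s +ℤ t) (fg≡ x) (wsum-map a b fg≡ cs xs) ⟩
  + c *ℤ (a *ℤ h x +ℤ b) +ℤ (a *ℤ wsum h cs xs +ℤ b *ℤ + sumℕ cs)
    ≡⟨ ring a b (+ c) (h x) (wsum h cs xs) (+ sumℕ cs) ⟩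
  a *ℤ (+ c *ℤ h x +ℤ wsum h cs xs) +ℤ b *ℤ (+ c +ℤ + sumℕ cs)
    ≡⟨ cong (λ s → a *ℤ (+ c *ℤ h x +ℤ wsum h cs xs) +ℤ b *ℤ s) (sym (ℤ.pos-+ c (sumℕ cs))) ⟩
  a *ℤ (+ c *ℤ h x +ℤ wsum h cs xs) +ℤ b *ℤ + (c + sumℕ cs) ∎
  where
  open ≡-Reasoning
  ring : ∀ a b c y w s → c *ℤ (a *ℤ y +ℤ b) +ℤ (a *ℤ w +ℤ b *ℤ s) ≡ a *ℤ (c *ℤ y +ℤ w) +ℤ b *ℤ (c +ℤ s)
  ring = solve-∀

wsum-replicate-0 : ∀ {f} → f (+ 0) ≡ + 0 → (cs : Vec ℕ n) → wsum f cs (replicate n (+ 0)) ≡ + 0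
wsum-replicate-0 f0≡0 []       = refl
wsum-replicate-0 f0≡0 (c ∷ cs) =
  trans (cong₂ (λ s t → + c *ℤ s +ℤ t) f0≡0 (wsum-replicate-0 f0≡0 cs)) (cong (_+ℤ + 0) (ℤ.*-zeroʳ (+ c)))

wsum-P4-3∤ : (cs : Vec ℕ n) {zs : Vec ℤ n} → All (λ z → ¬ + 3 ℤ.∣ z) zs →
  Σ (Vec ℤ n) λ ys → wsum P4 cs zs ≡ wsum P4 cs (map 3y-1 ys)
wsum-P4-3∤ []       []           = [] , refl
wsum-P4-3∤ (c ∷ cs) {z ∷ _} (3∤z ∷ 3∤zs) with 3∤⇒P4≡P4[3y-1] z 3∤z | wsum-P4-3∤ cs 3∤zs
... | y , z≡ | ys , zs≡ = y ∷ ys , cong₂ (λ s t → + c *ℤ s +ℤ t) z≡ zs≡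

Q-map-3y-1 : (α : Vec ℕ u) (β : Vec ℕ v) (x : Vec ℤ u) (y : Vec ℤ v) →
  Q α β x (map 3y-1 y) ≡ + 3 *ℤ Φ α β x y +ℤ + sumℕ β
Q-map-3y-1 α β x y = begin
  + 3 *ℤ wsum P4 α x +ℤ wsum P4 β (map 3y-1 y)
    ≡⟨ cong (+ 3 *ℤ wsum P4 α x +ℤ_) (wsum-map (+ 3) (+ 1) P4[3y-1]≡3P8+1 β y) ⟩
  + 3 *ℤ wsum P4 α x +ℤ (+ 3 *ℤ wsum P8 β y +ℤ + 1 *ℤ + sumℕ β)
    ≡⟨ ring (wsum P4 α x) (wsum P8 β y) (+ sumℕ β) ⟩
  + 3 *ℤ Φ α β x y +ℤ + sumℕ β ∎
  where
  open ≡-Reasoning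
  ring : ∀ a b s → + 3 *ℤ a +ℤ (+ 3 *ℤ b +ℤ + 1 *ℤ s) ≡ + 3 *ℤ (a +ℤ b) +ℤ s
  ring = solve-∀

Q-map-2* : (α : Vec ℕ u) (β : Vec ℕ v) (x : Vec ℤ u) (y : Vec ℤ v) →
  Q α β (map (+ 2 *ℤ_) x) (map (+ 2 *ℤ_) y) ≡ + 4 *ℤ Q α β x y
Q-map-2* α β x y = begin
  + 3 *ℤ wsum P4 α (map (+ 2 *ℤ_) x) +ℤ wsum P4 β (map (+ 2 *ℤ_) y)
    ≡⟨ cong₂ (λ s t → + 3 *ℤ s +ℤ t) (wsum-map (+ 4) (+ 0) P4[2x] α x) (wsum-map (+ 4) (+ 0) P4[2x] β y) ⟩
  + 3 *ℤ (+ 4 *ℤ wsum P4 α x +ℤ + 0 *ℤ + sumℕ α) +ℤ (+ 4 *ℤ wsum P4 β y +ℤ + 0 *ℤ + sumℕ β)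
    ≡⟨ ring (wsum P4 α x) (wsum P4 β y) (+ sumℕ α) (+ sumℕ β) ⟩
  + 4 *ℤ Q α β x y ∎
  where
  open ≡-Reasoning
  P4[2x] : ∀ x → (+ 2 *ℤ x) *ℤ (+ 2 *ℤ x) ≡ + 4 *ℤ (x *ℤ x) +ℤ + 0
  P4[2x] = solve-∀
  ring : ∀ a b s t → + 3 *ℤ (+ 4 *ℤ a +ℤ + 0 *ℤ s) +ℤ (+ 4 *ℤ b +ℤ + 0 *ℤ t) ≡ + 4 *ℤ (+ 3 *ℤ a +ℤ b)
  ring = solve-∀

+[3N+B]≡3N+B : ∀ N B → + (3 * N + B) ≡ + 3 *ℤ + N +ℤ + B
+[3N+B]≡3N+B N B = trans (ℤ.pos-+ (3 * N) B) (cong (_+ℤ + B) (ℤ.pos-* 3 N))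

universal⇔QSolvable[3N+B] : (α : Vec ℕ u) (β : Vec ℕ v) →
  Universal α β ⇔ ((N : ℕ) → QSolvable α β (+ (3 * N + sumℕ β)))
universal⇔QSolvable[3N+B] α β = mk⇔ to from
  where
  B : ℕ
  B = sumℕ β
  to : Universal α β → (N : ℕ) → QSolvable α β (+ (3 * N + B))
  to Φ-univ N with Φ-univ N
  ... | x , y , Φ≡N =
    x , map 3y-1 y ,
    trans (Q-map-3y-1 α β x y) (trans (cong (λ t → + 3 *ℤ t +ℤ + B) Φ≡N) (sym (+[3N+B]≡3N+B N B))) ,
    Equivalence.from (prime∤prodℤ⇔All∤ prime-3 (map 3y-1 y)) (map⁺ (All.universal 3∤3y-1 y))
  from : ((N : ℕ) → QSolvable α β (+ (3 * N + B))) → Universal α β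
  from Q-solv N with Q-solv N
  ... | x , z , Q≡ , 3∤prod with wsum-P4-3∤ β (Equivalence.to (prime∤prodℤ⇔All∤ prime-3 z) 3∤prod)
  ... | y , z≡ = x , y , ℤ.*-cancelˡ-≡ (+ 3) _ _ (∙-cancelʳ (+ B) _ _ 3Φ+B≡3N+B)
    where
    3Φ+B≡3N+B : + 3 *ℤ Φ α β x y +ℤ + B ≡ + 3 *ℤ + N +ℤ + B
    3Φ+B≡3N+B = begin
      + 3 *ℤ Φ α β x y +ℤ + B ≡⟨ Q-map-3y-1 α β x y ⟨
      Q α β x (map 3y-1 y)    ≡⟨ cong (+ 3 *ℤ wsum P4 α x +ℤ_) z≡ ⟨
      Q α β x z               ≡⟨ Q≡ ⟩
      + (3 * N + B)           ≡⟨ +[3N+B]≡3N+B N B ⟩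
      + 3 *ℤ + N +ℤ + B       ∎
      where open ≡-Reasoning

QSolvable-4* : (α : Vec ℕ u) (β : Vec ℕ v) (n : ℕ) → QSolvable α β (+ n) → QSolvable α β (+ (4 * n))
QSolvable-4* α β n (x , y , Q≡n , 3∤prod) =
  map (+ 2 *ℤ_) x , map (+ 2 *ℤ_) y ,
  trans (Q-map-2* α β x y) (trans (cong (+ 4 *ℤ_) Q≡n) (sym (ℤ.pos-* 4 n))) ,
  Equivalence.from (prime∤prodℤ⇔All∤ prime-3 (map (+ 2 *ℤ_) y))
    (map⁺ (All.map (λ {y} → prime∤* prime-3 (+ 2) y 3∤2)
                   (Equivalence.to (prime∤prodℤ⇔All∤ prime-3 y) 3∤prod)))
  where
  3∤2 : ¬ + 3 ℤ.∣ + 2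
  3∤2 = from-no (3 ℕ.∣? 2)

QSolvable-0 : (α : Vec ℕ u) (β : Vec ℕ v) → AllPos β → sumℕ β ≡ 0 → QSolvable α β (+ 0)
QSolvable-0 {u} α []           _          _ =
  replicate u (+ 0) , [] , cong (λ t → + 3 *ℤ t +ℤ + 0) (wsum-replicate-0 refl α) , from-no (3 ℕ.∣? 1)
QSolvable-0     α (suc _ ∷ _) _          ()
QSolvable-0     α (zero ∷ _)  (() , _)   _

m%d≡n%d⇒d*k+n≡m : ∀ d .{{_ : NonZero d}} {m n} → n ≤ m → m % d ≡ n % d → Σ ℕ λ k → d * k + n ≡ m
m%d≡n%d⇒d*k+n≡m d {m} {n} n≤m m≡n = k , trans (cong (_+ n) d*k≡m∸n) (ℕ.m∸n+n≡m n≤m)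
  where
  k : ℕ
  k = m / d ∸ n / d
  d*k≡m∸n : d * k ≡ m ∸ n
  d*k≡m∸n = begin
    d * k                                  ≡⟨ ℕ.*-comm d k ⟩
    (m / d ∸ n / d) * d                     ≡⟨ ℕ.*-distribʳ-∸ d (m / d) (n / d) ⟩
    (m / d) * d ∸ (n / d) * d               ≡⟨ ℕ.[m+n]∸[m+o]≡n∸o (m % d) _ _ ⟨
    m % d + (m / d) * d ∸ (m % d + (n / d) * d) ≡⟨ cong₂ _∸_ (sym (m≡m%n+[m/n]*n m d)) (cong (_+ (n / d) * d) m≡n) ⟩
    m ∸ (n % d + (n / d) * d)               ≡⟨ cong (m ∸_) (m≡m%n+[m/n]*n n d) ⟨
    m ∸ n                                   ∎
    where open ≡-Reasoning

3N+B≡4q⇒q%3≡B%3 : ∀ N B q → 3 * N + B ≡ 4 * q → q % 3 ≡ B % 3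
3N+B≡4q⇒q%3≡B%3 N B q e = begin
  q % 3            ≡⟨ %-remove-+ʳ q (ℕ.m∣m*n q) ⟨ -- 4 * q unfolds to q + 3 * q
  (4 * q) % 3      ≡⟨ cong (_% 3) e ⟨
  (3 * N + B) % 3  ≡⟨ %-remove-+ˡ B (ℕ.m∣m*n N) ⟩
  B % 3            ∎
  where open ≡-Reasoning

module Descent (B : ℕ) (S : ℕ → Set)
  (S-4* : ∀ n → S n → S (4 * n))
  (S-0 : B ≡ 0 → S 0)
  (S-E : ∀ n → InE B n → ∀ k → IsNu B n k → S (4 ^ k * n))
  (S-4∤ : (N : ℕ) → ¬ (4 ∣ 3 * N + B) → S (3 * N + B))
  where

  S-4q : ∀ {N} q → 0 < q → 3 * N + B ≡ 4 * q → (∀ N′ → 3 * N′ + B ≡ q → S q) → S (4 * q)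
  S-4q {N} q 0<q 3N+B≡4q S-q with q <? B | 3N+B≡4q⇒q%3≡B%3 N B q 3N+B≡4q
  ... | yes q<B | q%3≡B%3 = S-E q (0<q , q<B , q%3≡B%3) 1
                              (s≤s z≤n , subst (_< B) (sym (ℕ.*-identityˡ q)) q<B ,
                               subst (B ≤_) 3N+B≡4q (ℕ.m≤n+m B (3 * N)))
  ... | no q≮B  | q%3≡B%3 with m%d≡n%d⇒d*k+n≡m 3 (ℕ.≮⇒≥ q≮B) q%3≡B%3
  ...   | N′ , 3N′+B≡q = S-4* q (S-q N′ 3N′+B≡q)

  S-3N+B : ∀ N → S (3 * N + B)
  S-3N+B N = <-rec P step (3 * N + B) N refl
    where
    P : ℕ → Set
    P m = ∀ N → 3 * N + B ≡ m → S m
    step : ∀ m → (∀ {m′} → m′ < m → P m′) → P m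
    step _ rec N refl with 4 ℕ.∣? 3 * N + B
    ... | no 4∤ = S-4∤ N 4∤
    ... | yes (ℕ.divides zero 3N+B≡0) = subst S (sym 3N+B≡0) (S-0 (ℕ.m+n≡0⇒n≡0 (3 * N) 3N+B≡0))
    ... | yes (ℕ.divides q@(suc _) 3N+B≡q*4) =
      subst S (sym 3N+B≡4q) (S-4q {N} q (s≤s z≤n) 3N+B≡4q (rec q<3N+B))
      where
      3N+B≡4q : 3 * N + B ≡ 4 * q
      3N+B≡4q = trans 3N+B≡q*4 (ℕ.*-comm q 4)
      q<3N+B : q < 3 * N + B
      q<3N+B = subst (q <_) (sym 3N+B≡q*4) (ℕ.m<m*n q 4 (s≤s (s≤s z≤n)))

lemma4p1 : ∀ {u v} (α : Vec ℕ u) (β : Vec ℕ v) → AllPos α → AllPos β →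
    (∀ n → InE (sumℕ β) n → ∀ k → IsNu (sumℕ β) n k →
      QSolvable α β (+ (4 ^ k * n))) →
    (Universal α β ⇔
      ((N : ℕ) → ¬ (4 ∣ 3 * N + sumℕ β) → QSolvable α β (+ (3 * N + sumℕ β))))
lemma4p1 α β _ pos-β hyp = mk⇔ (λ Φ-univ N _ → to Φ-univ N) (from ∘ Q-solvable)
  where
  open Equivalence (universal⇔QSolvable[3N+B] α β)
  Q-solvable : ((N : ℕ) → ¬ (4 ∣ 3 * N + sumℕ β) → QSolvable α β (+ (3 * N + sumℕ β))) →
               (N : ℕ) → QSolvable α β (+ (3 * N + sumℕ β))
  Q-solvable = Descent.S-3N+B (sumℕ β) (QSolvable α β ∘ +_) (QSolvable-4* α β) (QSolvable-0 α β pos-β) hyp
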